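{- Let $G=(K\uplus S,E)$ be a connected split graph and $D_s,D_t$ two D$2$DSs of $G$ of the same size. Then $\mathrm{opt}_{\mathsf{TS}}(G,D_s,D_t)\le M^\star_{\mathsf{TS}}(G,D_s,D_t)+2$.
   Context: A split graph $G=(K\uplus S,E)$ has vertex set partitioned into a clique $K$ and an independent set $S$. A D$2$DS of $G$ is a set $D\subseteq V(G)$ such that every vertex is at distance at most $2$ from some vertex of $D$. A $\mathsf{TS}$-sequence between D$2$DSs $D_s,D_t$ is a sequence $D_s=D_0,\dots,D_q=D_t$ of D$2$DSs with $D_i\setminus D_{i+1}=\{x_i\}$, $D_{i+1}\setminus D_i=\{y_i\}$, $x_iy_i\in E(G)$ for each $i$; its length is $q$. $\mathrm{opt}_{\mathsf{TS}}(G,D_s,D_t)$ is the minimum length of such a sequence ($\infty$ if none). With $D_s=\{s_1,\dots,s_k\}$, $M^\star_{\mathsf{TS}}(G,D_s,D_t)=\min_f\sum_{i=1}^k\mathrm{dist}_G(s_i,f(s_i))$ over bijections $f:D_s\to D_t$. -}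

module Defs where

open import Data.Nat using (ℕ; zero; suc; _+_; _≤_)
open import Data.Fin using (Fin)
open import Data.Fin.Subset using (Subset; _∈_; _∉_; inside; outside; ∣_∣)
open import Data.Fin.Subset.Properties using (_∈?_)
open import Data.Vec using (_[_]≔_)
open import Data.List using (List; map; allFin)
open import Data.Nat.ListAction using (sum)
open import Data.Product using (Σ; ∃; ∃-syntax; _×_; proj₁; _,_)
open import Data.Empty using (⊥)
open import Relation.Nullary using (¬_; yes; no)
open import Relation.Binary.PropositionalEquality using (_≡_; _≢_)
open import Function.Bundles using (_⤖_; Bijection)

record Graph : Set₁ where
  field
    n      : ℕ
    Adj    : Fin n → Fin n → Set
    sym    : ∀ {u v} → Adj u v → Adj v u
    irrefl : ∀ v → ¬ Adj v v
open Graph public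

module _ (G : Graph) where
  private
    V = Fin (n G)

  data Walk : V → V → ℕ → Set where
    nil  : ∀ {v} → Walk v v zero
    cons : ∀ {u w v ℓ} → Adj G u w → Walk w v ℓ → Walk u v (suc ℓ)

  Dist : V → V → ℕ → Set
  Dist u v d = Walk u v d × (∀ ℓ → Walk u v ℓ → d ≤ ℓ)

  Connected : Set
  Connected = ∀ u v → ∃[ ℓ ] Walk u v ℓ

  IsSplit : Set
  IsSplit = ∃[ K ] ((∀ u v → u ∈ K → v ∈ K → u ≢ v → Adj G u v)
                  × (∀ u v → u ∉ K → v ∉ K → ¬ Adj G u v))

  IsD2DS : Subset (n G) → Set
  IsD2DS D = ∀ v → ∃[ u ] (u ∈ D × ∃[ ℓ ] (ℓ ≤ 2 × Walk u v ℓ))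

  TSStep : Subset (n G) → Subset (n G) → Set
  TSStep D D' = ∃[ x ] ∃[ y ] (x ∈ D × y ∉ D × Adj G x y
                × D' ≡ (D [ x ]≔ outside) [ y ]≔ inside)

  data TSSeq : Subset (n G) → Subset (n G) → ℕ → Set where
    done : ∀ {D} → IsD2DS D → TSSeq D D zero
    step : ∀ {D D' Dt q} → IsD2DS D → TSStep D D' → TSSeq D' Dt q
         → TSSeq D Dt (suc q)

  Elem : Subset (n G) → Set
  Elem D = Σ V (_∈ D)

  sumOver : (D : Subset (n G)) → ((v : V) → v ∈ D → ℕ) → ℕ
  sumOver D h = sum (map f (allFin (n G)))
    where
      f : V → ℕ
      f v with v ∈? D
      ... | yes p = h v p
      ... | no _  = 0

  MatchingCost : Subset (n G) → Subset (n G) → ℕ → Set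
  MatchingCost Ds Dt c =
    Σ (Elem Ds ⤖ Elem Dt) λ f → ∃[ d ] ((∀ v (p : v ∈ Ds) →
                      Dist v (proj₁ (Bijection.to f (v , p))) (d v p))
                   × c ≡ sumOver Ds d)

  IsMStar : Subset (n G) → Subset (n G) → ℕ → Set
  IsMStar Ds Dt m = MatchingCost Ds Dt m × (∀ c → MatchingCost Ds Dt c → m ≤ c)

module Submission where

-- Give each vertex of Ds a token walking along a shortest path to its partner under a bijection
-- Ds → Dt; the potential is the total length of the remaining walks, initially the cost of the
-- bijection (any bijection works, not only an optimal one). If some target t is not yet
-- occupied, the walk towards t leaves the current set at an edge xy; x hands its own walk to the
-- token that started the walk and slides along xy. This is one TS-move and lowers the potential.
-- It keeps a distance-2 dominating set unless x was the only clique vertex of the set and the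
-- clique has another vertex k₂. Walks in a split graph shortcut to walks of length at most 3
-- through the clique, so then either some walk leaves the set into the clique (a safe move), or
-- all walks can be made to avoid k₂. In the latter case x is parked on k₂, which dominates
-- everything for the rest of the process; the token on k₂ is delivered last, in at most two
-- moves. Parking costs one move and raises the potential by one: hence the additive 2.

open import Defs renaming (sym to adj-sym)
open import Data.Nat using (ℕ; zero; suc; _+_; _≤_; _<_; z≤n; s≤s)
open import Data.Nat.Properties
  using (+-0-commutativeMonoid; +-comm; +-assoc; +-suc; +-identityʳ; +-cancelʳ-≤; +-cancelʳ-≡;
         +-mono-≤; +-monoʳ-≤; +-monoˡ-≤; m≤m+n; m≤n+m; ≤-refl; ≤-reflexive; ≤-trans; ≤-pred; <-irrefl;
         module ≤-Reasoning)
open import Data.Nat.ListAction using (sum)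
open import Data.Nat.Tactic.RingSolver using (solve-∀)
open import Data.Fin using (Fin; zero; suc; punchIn)
open import Data.Fin.Properties using (any?; punchInᵢ≢i) renaming (_≟_ to _≟ᶠ_)
open import Data.Fin.Subset using (Subset; _∈_; _∉_; _⊆_; inside; outside; ∣_∣)
open import Data.Fin.Subset.Properties using (_∈?_; p⊂q⇒∣p∣<∣q∣; ⊆-antisym)
open import Data.Vec using (_∷_; _[_]≔_; here; there)
open import Data.Vec.Properties
  using ([]=⇒lookup; lookup⇒[]=; []=-injective; []≔-updates; []≔-minimal; lookup∘update′)
open import Data.List using (map; tabulate; allFin)
open import Algebra.Properties.CommutativeMonoid.Sum +-0-commutativeMonoid
  using (sum-remove; sum-cong-≗) renaming (sum to ∑)
open import Data.Product using (Σ; ∃; ∃-syntax; _×_; _,_; proj₁; proj₂)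
open import Data.Sum using (_⊎_; inj₁; inj₂)
open import Data.Empty using (⊥-elim)
open import Data.Unit using (⊤; tt)
open import Relation.Nullary using (¬_; yes; no; _×-dec_; ¬?)
open import Relation.Binary.PropositionalEquality
  using (_≡_; _≢_; refl; sym; trans; cong; cong₂; subst; module ≡-Reasoning)
open import Function.Base using (_∘_; id)
open import Function.Bundles using (Bijection; _⤖_)
open import Data.Vec.Properties.WithK using ([]=-irrelevant)

∑-≥ : ∀ {m} (f : Fin m → ℕ) (a : Fin m) → f a ≤ ∑ f
∑-≥ {suc m} f a = ≤-trans (m≤m+n (f a) _) (≤-reflexive (sym (sum-remove f)))

∑-mono : ∀ {m} {f g : Fin m → ℕ} → (∀ v → f v ≤ g v) → ∑ f ≤ ∑ g
∑-mono {zero}  f≤g = z≤n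
∑-mono {suc m} f≤g = +-mono-≤ (f≤g zero) (∑-mono (f≤g ∘ suc))

∑-agree-except : ∀ {m} {f g : Fin m → ℕ} (a : Fin m) →
                 (∀ v → v ≢ a → f v ≡ g v) → ∑ f + g a ≡ ∑ g + f a
∑-agree-except {suc m} {f} {g} a agree = begin
  ∑ f + g a                      ≡⟨ cong (_+ g a) (sum-remove f) ⟩
  f a + ∑ (f ∘ punchIn a) + g a  ≡⟨ cong (λ r → f a + r + g a) (sum-cong-≗ (λ j → agree _ (punchInᵢ≢i a j))) ⟩
  f a + ∑ (g ∘ punchIn a) + g a  ≡⟨ swap-ends (f a) _ (g a) ⟩
  g a + ∑ (g ∘ punchIn a) + f a  ≡⟨ cong (_+ f a) (sum-remove g) ⟨
  ∑ g + f a                      ∎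
  where
  open ≡-Reasoning
  swap-ends : ∀ x r y → x + r + y ≡ y + r + x
  swap-ends = solve-∀

∑-agree-except₂ : ∀ {m} {f g : Fin m → ℕ} {a b : Fin m} → a ≢ b →
                  (∀ v → v ≢ a → v ≢ b → f v ≡ g v) → ∑ f + (g a + g b) ≡ ∑ g + (f a + f b)
∑-agree-except₂ {f = f} {g} {a} {b} a≢b agree = begin
  ∑ f + (g a + g b)  ≡⟨ +-assoc (∑ f) _ _ ⟨
  ∑ f + g a + g b    ≡⟨ cong (λ z → ∑ f + z + g b) h-at ⟨
  ∑ f + h a + g b    ≡⟨ cong (_+ g b) (∑-agree-except a f≡h) ⟩
  ∑ h + f a + g b    ≡⟨ shuffle (∑ h) (f a) (g b) ⟩
  ∑ h + g b + f a    ≡⟨ cong (_+ f a) (∑-agree-except b h≡g) ⟩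
  ∑ g + h b + f a    ≡⟨ cong (λ z → ∑ g + z + f a) (h-elsewhere b (a≢b ∘ sym)) ⟩
  ∑ g + f b + f a    ≡⟨ shuffle (∑ g) (f b) (f a) ⟩
  ∑ g + f a + f b    ≡⟨ +-assoc (∑ g) _ _ ⟩
  ∑ g + (f a + f b)  ∎
  where
  open ≡-Reasoning
  shuffle : ∀ x y z → x + y + z ≡ x + z + y
  shuffle = solve-∀
  h : Fin _ → ℕ
  h v with v ≟ᶠ a
  ... | yes _ = g a
  ... | no  _ = f v
  h-elsewhere : ∀ v → v ≢ a → h v ≡ f v
  h-elsewhere v v≢a with v ≟ᶠ a
  ... | yes v≡a = ⊥-elim (v≢a v≡a)
  ... | no  _   = refl
  h-at : h a ≡ g a
  h-at with a ≟ᶠ a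
  ... | yes _   = refl
  ... | no  a≢a = ⊥-elim (a≢a refl)
  f≡h : ∀ v → v ≢ a → f v ≡ h v
  f≡h v v≢a = sym (h-elsewhere v v≢a)
  h≡g : ∀ v → v ≢ b → h v ≡ g v
  h≡g v v≢b with v ≟ᶠ a
  ... | yes refl = refl
  ... | no  v≢a  = agree v v≢a v≢b

sum-map-tabulate : ∀ {m k} (g : Fin k → ℕ) (h : Fin m → Fin k) → sum (map g (tabulate h)) ≡ ∑ (g ∘ h)
sum-map-tabulate {zero}  g h = refl
sum-map-tabulate {suc m} g h = cong (g (h zero) +_) (sum-map-tabulate g (h ∘ suc))

-- sumOver's summand is local to its definition; unifying with its unfolding recovers it.
summandOf : ∀ {m} {F : Fin m → ℕ} {x} → x ≡ sum (map F (allFin m)) → Fin m → ℕ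
summandOf {F = F} _ = F

≤-from-+-≡ : ∀ {A B a b} → A + a ≡ B + b → b ≤ a → A ≤ B
≤-from-+-≡ {A} {B} {a} eq b≤a = +-cancelʳ-≤ a A B (≤-trans (≤-reflexive eq) (+-monoʳ-≤ B b≤a))

≡-from-+-suc : ∀ {a b c} → a + b ≡ c + suc b → a ≡ suc c
≡-from-+-suc {a} {b} {c} eq = +-cancelʳ-≡ b a (suc c) (trans eq (+-suc c b))

some-or-all : ∀ {m} {X Y : Fin m → Set} → (∀ v → X v ⊎ Y v) → ∃ X ⊎ (∀ v → Y v)
some-or-all {zero}  choice = inj₂ (λ ())
some-or-all {suc m} choice with choice zero | some-or-all (choice ∘ suc)
... | inj₁ X₀ | _                = inj₁ (zero , X₀)
... | inj₂ _  | inj₁ (v , Xv)    = inj₁ (suc v , Xv)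
... | inj₂ Y₀ | inj₂ Y₊          = inj₂ (λ { zero → Y₀ ; (suc v) → Y₊ v })

¬∃≢⇒≡ : ∀ {m} {P : Fin m → Set} {x} → ¬ ∃ (λ a → P a × a ≢ x) → ∀ {a} → P a → a ≡ x
¬∃≢⇒≡ {x = x} none {a} Pa with a ≟ᶠ x
... | yes a≡x = a≡x
... | no  a≢x = ⊥-elim (none (a , Pa , a≢x))

∈-update⁻ : ∀ {m} {F : Subset m} {y v b} → v ≢ y → v ∈ F [ y ]≔ b → v ∈ F
∈-update⁻ {F = F} {y} {v} {b} v≢y v∈ = lookup⇒[]= v F (trans (sym (lookup∘update′ v≢y F b)) ([]=⇒lookup v∈))

∉-remove : ∀ {m} {F : Subset m} {x} → x ∉ F [ x ]≔ outside
∉-remove {F = F} {x} x∈ with () ← []=-injective ([]≔-updates F x) x∈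

move : ∀ {m} → Subset m → Fin m → Fin m → Subset m
move D x y = (D [ x ]≔ outside) [ y ]≔ inside

module _ {m} {D : Subset m} {x y : Fin m} where

  ∈-move-target : y ∈ move D x y
  ∈-move-target = []≔-updates (D [ x ]≔ outside) y

  ∉-move-source : x ≢ y → x ∉ move D x y
  ∉-move-source x≢y = ∉-remove ∘ ∈-update⁻ x≢y

  ∈-move⁺ : ∀ {v} → v ≢ x → v ∈ D → v ∈ move D x y
  ∈-move⁺ {v} v≢x v∈D with v ≟ᶠ y
  ... | yes refl = ∈-move-target
  ... | no  v≢y  = []≔-minimal _ v y v≢y ([]≔-minimal D v x v≢x v∈D)

  ∈-move⁻ : ∀ {v} → v ≢ y → v ∈ move D x y → v ∈ D
  ∈-move⁻ {v} v≢y v∈ with v ≟ᶠ x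
  ... | yes refl = ⊥-elim (∉-remove (∈-update⁻ v≢y v∈))
  ... | no  v≢x  = ∈-update⁻ v≢x (∈-update⁻ v≢y v∈)

∣insert∣ : ∀ {m} (D : Subset m) (i : Fin m) → i ∉ D → ∣ D [ i ]≔ inside ∣ ≡ suc ∣ D ∣
∣insert∣ (outside ∷ D) zero    i∉D = refl
∣insert∣ (inside  ∷ D) zero    i∉D = ⊥-elim (i∉D here)
∣insert∣ (outside ∷ D) (suc i) i∉D = ∣insert∣ D i (i∉D ∘ there)
∣insert∣ (inside  ∷ D) (suc i) i∉D = cong suc (∣insert∣ D i (i∉D ∘ there))

∣remove∣ : ∀ {m} (D : Subset m) (i : Fin m) → i ∈ D → suc ∣ D [ i ]≔ outside ∣ ≡ ∣ D ∣
∣remove∣ (inside  ∷ D) zero    here        = refl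
∣remove∣ (outside ∷ D) (suc i) (there i∈D) = ∣remove∣ D i i∈D
∣remove∣ (inside  ∷ D) (suc i) (there i∈D) = cong suc (∣remove∣ D i i∈D)

∣move∣ : ∀ {m} (D : Subset m) {x y} → x ∈ D → y ∉ D → ∣ move D x y ∣ ≡ ∣ D ∣
∣move∣ D {x} {y} x∈D y∉D = trans (∣insert∣ (D [ x ]≔ outside) y y∉D′) (∣remove∣ D x x∈D)
  where
  y∉D′ : y ∉ D [ x ]≔ outside
  y∉D′ y∈ with y ≟ᶠ x
  ... | yes refl = ∉-remove y∈
  ... | no  y≢x  = y∉D (∈-update⁻ y≢x y∈)

⊆-∣∣-≡ : ∀ {m} {E F : Subset m} → E ⊆ F → ∣ F ∣ ≡ ∣ E ∣ → F ≡ E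
⊆-∣∣-≡ {E = E} {F} E⊆F ∣F∣≡∣E∣ = ⊆-antisym F⊆E E⊆F
  where
  F⊆E : F ⊆ E
  F⊆E {v} v∈F with v ∈? E
  ... | yes v∈E = v∈E
  ... | no  v∉E = ⊥-elim (<-irrefl (sym ∣F∣≡∣E∣) (p⊂q⇒∣p∣<∣q∣ (E⊆F , v , v∈F , v∉E)))

module WalkRoutes (G : Graph) where

  V : Set
  V = Fin (n G)

  _++ʷ_ : ∀ {a b c i j} → Walk G a b i → Walk G b c j → Walk G a c (i + j)
  nil      ++ʷ w′ = w′
  cons e w ++ʷ w′ = cons e (w ++ʷ w′)

  Along : ∀ {u v ℓ} → (V → Set) → Walk G u v ℓ → Set
  Along P (nil {v})      = P v
  Along P (cons {u} e w) = P u × Along P w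

  Along-last : ∀ {P : V → Set} {u v ℓ} (w : Walk G u v ℓ) → Along P w → P v
  Along-last nil        Pv       = Pv
  Along-last (cons e w) (_ , Pw) = Along-last w Pw

  Along-++ : ∀ {P : V → Set} {a b c i j} (w : Walk G a b i) (w′ : Walk G b c j) →
             Along P w → Along P w′ → Along P (w ++ʷ w′)
  Along-++ nil        w′ _         Pw′ = Pw′
  Along-++ (cons e w) w′ (Pa , Pw) Pw′ = Pa , Along-++ w w′ Pw Pw′

  Along-⊤ : ∀ {u v ℓ} (w : Walk G u v ℓ) → Along (λ _ → ⊤) w
  Along-⊤ nil        = tt
  Along-⊤ (cons e w) = tt , Along-⊤ w

  record Route (v : V) : Set where
    constructor route
    field
      target : V
      len    : ℕ
      walk   : Walk G v target len
  open Route public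

  _◂_ : ∀ {u v} → Adj G u v → Route v → Route u
  e ◂ ρ = route (target ρ) (suc (len ρ)) (cons e (walk ρ))

  _▹_ : ∀ {u v i} → Walk G u v i → Route v → Route u
  _▹_ {i = i} w ρ = route (target ρ) (i + len ρ) (w ++ʷ walk ρ)

  Routes : Set
  Routes = (v : V) → Route v

  setRoute : Routes → (a : V) → Route a → Routes
  setRoute r a ρ v with a ≟ᶠ v
  ... | yes refl = ρ
  ... | no  _    = r v

  setRoute-here : ∀ r a ρ → setRoute r a ρ a ≡ ρ
  setRoute-here r a ρ with a ≟ᶠ a
  ... | yes refl = refl
  ... | no  a≢a  = ⊥-elim (a≢a refl)

  setRoute-elsewhere : ∀ r a ρ {v} → v ≢ a → setRoute r a ρ v ≡ r v
  setRoute-elsewhere r a ρ {v} v≢a with a ≟ᶠ v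
  ... | yes refl = ⊥-elim (v≢a refl)
  ... | no  _    = refl

  weight : Subset (n G) → Routes → V → ℕ
  weight D r v with v ∈? D
  ... | yes _ = len (r v)
  ... | no  _ = 0

  weight-∈ : ∀ {D r v} → v ∈ D → weight D r v ≡ len (r v)
  weight-∈ {D} {r} {v} v∈D with v ∈? D
  ... | yes _   = refl
  ... | no  v∉D = ⊥-elim (v∉D v∈D)

  weight-∉ : ∀ {D r v} → v ∉ D → weight D r v ≡ 0
  weight-∉ {D} {r} {v} v∉D with v ∈? D
  ... | yes v∈D = ⊥-elim (v∉D v∈D)
  ... | no  _   = refl

  cost : Subset (n G) → Routes → ℕ
  cost D r = ∑ (weight D r)

  len≤cost : ∀ {D r v} → v ∈ D → len (r v) ≤ cost D r
  len≤cost {D} {r} {v} v∈D = ≤-trans (≤-reflexive (sym (weight-∈ v∈D))) (∑-≥ (weight D r) v)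

  cost-mono : ∀ {D r r′} → (∀ v → v ∈ D → len (r′ v) ≤ len (r v)) → cost D r′ ≤ cost D r
  cost-mono {D} {r} {r′} shorter = ∑-mono pointwise
    where
    pointwise : ∀ v → weight D r′ v ≤ weight D r v
    pointwise v with v ∈? D
    ... | yes v∈D = shorter v v∈D
    ... | no  _   = z≤n

  weight-agree : ∀ {D D′ r r′ v} → (v ∈ D′ → v ∈ D) → (v ∈ D → v ∈ D′) → r′ v ≡ r v →
                 weight D′ r′ v ≡ weight D r v
  weight-agree {D} {D′} {v = v} to from eq with v ∈? D
  ... | yes v∈D = trans (weight-∈ (from v∈D)) (cong len eq)
  ... | no  v∉D = weight-∉ (v∉D ∘ to)

  cost-agree : ∀ {D r r′ a} → a ∈ D → (∀ v → v ≢ a → r′ v ≡ r v) →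
               cost D r′ + len (r a) ≡ cost D r + len (r′ a)
  cost-agree {D} {r} {r′} {a} a∈D agree = begin
    cost D r′ + len (r a)         ≡⟨ cong (cost D r′ +_) (weight-∈ a∈D) ⟨
    cost D r′ + weight D r a      ≡⟨ ∑-agree-except a (λ v v≢a → weight-agree id id (agree v v≢a)) ⟩
    cost D r + weight D r′ a      ≡⟨ cong (cost D r +_) (weight-∈ a∈D) ⟩
    cost D r + len (r′ a)         ∎
    where open ≡-Reasoning

  cost-agree₂ : ∀ {D r r′ a b} → a ≢ b → a ∈ D → b ∈ D → (∀ v → v ≢ a → v ≢ b → r′ v ≡ r v) →
                cost D r′ + (len (r a) + len (r b)) ≡ cost D r + (len (r′ a) + len (r′ b))
  cost-agree₂ {D} {r} {r′} {a} {b} a≢b a∈D b∈D agree = begin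
    cost D r′ + (len (r a) + len (r b))
      ≡⟨ cong (cost D r′ +_) (cong₂ _+_ (weight-∈ a∈D) (weight-∈ b∈D)) ⟨
    cost D r′ + (weight D r a + weight D r b)
      ≡⟨ ∑-agree-except₂ a≢b (λ v v≢a v≢b → weight-agree id id (agree v v≢a v≢b)) ⟩
    cost D r + (weight D r′ a + weight D r′ b)
      ≡⟨ cong (cost D r +_) (cong₂ _+_ (weight-∈ a∈D) (weight-∈ b∈D)) ⟩
    cost D r + (len (r′ a) + len (r′ b))
      ∎
    where open ≡-Reasoning

  cost-move : ∀ {D r x y} (ρ : Route y) → x ∈ D → y ∉ D →
              cost (move D x y) (setRoute r y ρ) + len (r x) ≡ cost D r + len ρ
  cost-move {D} {r} {x} {y} ρ x∈D y∉D = begin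
    cost D′ r′ + len (r x)                    ≡⟨ cong (cost D′ r′ +_) (+-identityʳ _) ⟨
    cost D′ r′ + (len (r x) + 0)              ≡⟨ cong (cost D′ r′ +_) (cong₂ _+_ (weight-∈ x∈D) (weight-∉ y∉D)) ⟨
    cost D′ r′ + (weight D r x + weight D r y) ≡⟨ ∑-agree-except₂ x≢y agree ⟩
    cost D r + (weight D′ r′ x + weight D′ r′ y)
      ≡⟨ cong (cost D r +_) (cong₂ _+_ (weight-∉ (∉-move-source x≢y)) y-weight) ⟩
    cost D r + (0 + len ρ)                    ∎
    where
    open ≡-Reasoning
    D′ = move D x y
    r′ = setRoute r y ρ
    x≢y : x ≢ y
    x≢y refl = y∉D x∈D
    y-weight : weight D′ r′ y ≡ len ρ
    y-weight = trans (weight-∈ {r = r′} (∈-move-target {D = D} {x = x})) (cong len (setRoute-here r y ρ))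
    agree : ∀ v → v ≢ x → v ≢ y → weight D′ r′ v ≡ weight D r v
    agree v v≢x v≢y = weight-agree (∈-move⁻ v≢y) (∈-move⁺ v≢x) (setRoute-elsewhere r y ρ v≢y)

  record Exit (D : Subset (n G)) (P : V → Set) (s u : V) (L : ℕ) : Set where
    constructor exitVia
    field
      {x y}         : V
      {i j}         : ℕ
      x∈D           : x ∈ D
      y∉D           : y ∉ D
      prefix        : Walk G s x i
      edge          : Adj G x y
      suffix        : Walk G y u j
      fits          : i + suc j ≤ L
      prefix-along  : Along P prefix
      suffix-along  : Along P suffix

  exit : ∀ {D P s u ℓ} (w : Walk G s u ℓ) → Along P w → s ∈ D → u ∉ D → Exit D P s u ℓ
  exit nil _ s∈D u∉D = ⊥-elim (u∉D s∈D)
  exit {D} (cons {w = w} e rest) (Ps , Prest) s∈D u∉D with w ∈? D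
  ... | no  w∉D = exitVia s∈D w∉D nil e rest ≤-refl Ps Prest
  ... | yes w∈D with exit rest Prest w∈D u∉D
  ...   | exitVia x∈D y∉D pre e′ suf fits Ppre Psuf =
          exitVia x∈D y∉D (cons e pre) e′ suf (s≤s fits) (Ps , Ppre) Psuf

  Exit-weaken : ∀ {D P s u L L′} → L ≤ L′ → Exit D P s u L → Exit D P s u L′
  Exit-weaken L≤L′ (exitVia x∈D y∉D pre e suf fits Ppre Psuf) =
    exitVia x∈D y∉D pre e suf (≤-trans fits L≤L′) Ppre Psuf

module SplitGraph (G : Graph) (K : Subset (n G))
  (clique : ∀ u v → u ∈ K → v ∈ K → u ≢ v → Adj G u v)
  (independent : ∀ u v → u ∉ K → v ∉ K → ¬ Adj G u v) where

  open WalkRoutes G using (V)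

  adj-to-clique : ∀ {u v} → Adj G u v → u ∉ K → v ∈ K
  adj-to-clique {u} {v} e u∉K with v ∈? K
  ... | yes v∈K = v∈K
  ... | no  v∉K = ⊥-elim (independent u v u∉K v∉K e)

  data Shortcut : V → V → ℕ → Set where
    stay : ∀ {u} → Shortcut u u 0
    hop  : ∀ {u v} → Adj G u v → Shortcut u v 1
    via  : ∀ {u v} a → a ∈ K → Adj G u a → Adj G a v → Shortcut u v 2
    via₂ : ∀ {u v} a b → a ∈ K → b ∈ K → Adj G u a → Adj G a b → Adj G b v → Shortcut u v 3

  NearClique : V → Set
  NearClique u = u ∈ K ⊎ ∃[ a ] (a ∈ K × Adj G u a)

  near-clique : ∀ {u v} → Adj G u v → NearClique u
  near-clique {u} e with u ∈? K
  ... | yes u∈K = inj₁ u∈K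
  ... | no  u∉K = inj₂ (_ , adj-to-clique e u∉K , e)

  shortcut-near : ∀ {u v} → NearClique u → NearClique v → ∃[ ℓ ] (ℓ ≤ 3 × Shortcut u v ℓ)
  shortcut-near {u} {v} (inj₁ u∈K) (inj₁ v∈K) with u ≟ᶠ v
  ... | yes refl = 0 , z≤n , stay
  ... | no  u≢v  = 1 , s≤s z≤n , hop (clique u v u∈K v∈K u≢v)
  shortcut-near {u} {v} (inj₂ (a , a∈K , ua)) (inj₁ v∈K) with a ≟ᶠ v
  ... | yes refl = 1 , s≤s z≤n , hop ua
  ... | no  a≢v  = 2 , s≤s (s≤s z≤n) , via a a∈K ua (clique a v a∈K v∈K a≢v)
  shortcut-near {u} {v} (inj₁ u∈K) (inj₂ (b , b∈K , vb)) with u ≟ᶠ b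
  ... | yes refl = 1 , s≤s z≤n , hop (adj-sym G vb)
  ... | no  u≢b  = 2 , s≤s (s≤s z≤n) , via b b∈K (clique u b u∈K b∈K u≢b) (adj-sym G vb)
  shortcut-near {u} {v} (inj₂ (a , a∈K , ua)) (inj₂ (b , b∈K , vb)) with a ≟ᶠ b
  ... | yes refl = 2 , s≤s (s≤s z≤n) , via a a∈K ua (adj-sym G vb)
  ... | no  a≢b  = 3 , ≤-refl , via₂ a b a∈K b∈K ua (clique a b a∈K b∈K a≢b) (adj-sym G vb)

  last-edge : ∀ {u v ℓ} → Walk G u v (suc ℓ) → ∃[ b ] Adj G b v
  last-edge (cons e nil)          = _ , e
  last-edge (cons e (cons e′ w)) = last-edge (cons e′ w)

  shortcut : ∀ {u v ℓ} → Walk G u v ℓ → ∃[ ℓ′ ] (ℓ′ ≤ ℓ × Shortcut u v ℓ′)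
  shortcut nil          = 0 , z≤n , stay
  shortcut (cons e nil) = 1 , ≤-refl , hop e
  shortcut (cons {u = u} {w = w} e (cons {v = v} e′ nil)) with w ∈? K
  ... | yes w∈K = 2 , ≤-refl , via w w∈K e e′
  ... | no  w∉K with u ≟ᶠ v
  ...   | yes refl = 0 , z≤n , stay
  ...   | no  u≢v  = 1 , s≤s z≤n , hop (clique u v (adj-to-clique (adj-sym G e) w∉K) (adj-to-clique e′ w∉K) u≢v)
  shortcut w@(cons e (cons _ (cons _ _))) with shortcut-near (near-clique e) (near-clique (adj-sym G (proj₂ (last-edge w))))
  ... | ℓ , ℓ≤3 , sc = ℓ , ≤-trans ℓ≤3 (s≤s (s≤s (s≤s z≤n))) , sc

  module _ (connected : Connected G) where

    clique-neighbour : ∀ {v u} → v ∉ K → v ≢ u → ∃[ a ] (a ∈ K × Adj G v a)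
    clique-neighbour {v} {u} v∉K v≢u with connected v u
    ... | _ , nil      = ⊥-elim (v≢u refl)
    ... | _ , cons e _ = _ , adj-to-clique e v∉K , e

    clique-vertex-dominates : ∀ {D k} → k ∈ K → k ∈ D → IsD2DS G D
    clique-vertex-dominates {D} {k} k∈K k∈D v with v ≟ᶠ k
    ... | yes refl = k , k∈D , 0 , z≤n , nil
    ... | no  v≢k with v ∈? K
    ...   | yes v∈K = k , k∈D , 1 , s≤s z≤n , cons (clique k v k∈K v∈K (v≢k ∘ sym)) nil
    ...   | no  v∉K with clique-neighbour v∉K v≢k
    ...     | a , a∈K , va with a ≟ᶠ k
    ...       | yes refl = k , k∈D , 1 , s≤s z≤n , cons (adj-sym G va) nil
    ...       | no  a≢k  = k , k∈D , 2 , ≤-refl , cons (clique k a k∈K a∈K (a≢k ∘ sym)) (cons (adj-sym G va) nil)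

    leaf-of-star-dominates : ∀ {D k y} → (∀ a → a ∈ K → a ≡ k) → Adj G k y → y ∈ D → IsD2DS G D
    leaf-of-star-dominates {D} {k} {y} K⊆k ky y∈D v with v ≟ᶠ y
    ... | yes refl = y , y∈D , 0 , z≤n , nil
    ... | no  v≢y with v ∈? K
    ...   | yes v∈K rewrite K⊆k v v∈K = y , y∈D , 1 , s≤s z≤n , cons (adj-sym G ky) nil
    ...   | no  v∉K with clique-neighbour v∉K v≢y
    ...     | a , a∈K , va rewrite K⊆k a a∈K = y , y∈D , 2 , ≤-refl , cons (adj-sym G ky) (cons (adj-sym G va) nil)

module Reconfiguration (G : Graph) (K : Subset (n G))
  (clique : ∀ u v → u ∈ K → v ∈ K → u ≢ v → Adj G u v)
  (independent : ∀ u v → u ∉ K → v ∉ K → ¬ Adj G u v)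
  (connected : Connected G) (E : Subset (n G)) (E-d2ds : IsD2DS G E) where

  open WalkRoutes G
  open SplitGraph G K clique independent

  -- Routes of vertices outside D are junk: cost ignores them.
  record Config (D : Subset (n G)) : Set where
    field
      routes : Routes
      covers : ∀ {t} → t ∈ E → ∃[ v ] (v ∈ D × target (routes v) ≡ t)
      size   : ∣ D ∣ ≡ ∣ E ∣
  open Config public

  cost⟨_⟩ : ∀ {D} → Config D → ℕ
  cost⟨_⟩ {D} σ = cost D (routes σ)

  arrived : ∀ {D} → IsD2DS G D → Config D → E ⊆ D → TSSeq G D E 0
  arrived d σ E⊆D = subst (λ F → TSSeq G _ F 0) (⊆-∣∣-≡ E⊆D (size σ)) (done d)

  relocate : ∀ {D x y} (σ : Config D) → x ∈ D → y ∉ D → (ρ : Route y) →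
             target ρ ≡ target (routes σ x) → Config (move D x y)
  relocate {D} {x} {y} σ x∈D y∉D ρ same-target = record
    { routes = setRoute (routes σ) y ρ
    ; covers = covers′
    ; size   = trans (∣move∣ D x∈D y∉D) (size σ)
    }
    where
    covers′ : ∀ {t} → t ∈ E → ∃[ v ] (v ∈ move D x y × target (setRoute (routes σ) y ρ v) ≡ t)
    covers′ t∈E with covers σ t∈E
    ... | v , v∈D , refl with v ≟ᶠ x
    ...   | yes refl = y , ∈-move-target , trans (cong target (setRoute-here (routes σ) y ρ)) same-target
    ...   | no  v≢x  = v , ∈-move⁺ v≢x v∈D , cong target (setRoute-elsewhere (routes σ) y ρ v≢y)
      where
      v≢y : v ≢ y
      v≢y refl = y∉D v∈D

  module Advance {D P s L} (σ : Config D) (s∈D : s ∈ D)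
                 (ex : Exit D P s (target (routes σ s)) L) (L≤len : L ≤ len (routes σ s)) where

    open Exit ex public

    r : Routes
    r = routes σ

    tail : Route y
    tail = route (target (r s)) j suffix

    -- x hands its route to s and takes over the rest of s's route; if x = s the second update wins.
    r₁ : Routes
    r₁ = setRoute (setRoute r s (prefix ▹ r x)) x (edge ◂ tail)

    r₁-x : r₁ x ≡ edge ◂ tail
    r₁-x = setRoute-here _ x _

    r₁-s : x ≢ s → r₁ s ≡ prefix ▹ r x
    r₁-s x≢s = trans (setRoute-elsewhere _ x _ (x≢s ∘ sym)) (setRoute-here r s _)

    r₁-other : ∀ {v} → v ≢ s → v ≢ x → r₁ v ≡ r v
    r₁-other v≢s v≢x = trans (setRoute-elsewhere _ x _ v≢x) (setRoute-elsewhere r s _ v≢s)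

    rerouted : Config D
    rerouted = record { routes = r₁ ; covers = covers₁ ; size = size σ }
      where
      covers₁ : ∀ {t} → t ∈ E → ∃[ v ] (v ∈ D × target (r₁ v) ≡ t)
      covers₁ t∈E with covers σ t∈E
      ... | v , v∈D , refl with v ≟ᶠ s
      ...   | yes refl = x , x∈D , cong target r₁-x
      ...   | no  v≢s with v ≟ᶠ x
      ...     | yes refl = s , s∈D , cong target (r₁-s v≢s)
      ...     | no  v≢x  = v , v∈D , cong target (r₁-other v≢s v≢x)

    rerouted-cost : cost⟨ rerouted ⟩ ≤ cost⟨ σ ⟩
    rerouted-cost with x ≟ᶠ s
    ... | yes x≡s = ≤-from-+-≡ (cost-agree x∈D agree) (≤-trans exit-fits (≤-reflexive (cong (len ∘ r) (sym x≡s))))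
      where
      agree : ∀ v → v ≢ x → r₁ v ≡ r v
      agree v v≢x = r₁-other (λ v≡s → v≢x (trans v≡s (sym x≡s))) v≢x
      exit-fits : len (r₁ x) ≤ len (r s)
      exit-fits = ≤-trans (≤-reflexive (cong len r₁-x)) (≤-trans (m≤n+m (suc j) i) (≤-trans fits L≤len))
    ... | no  x≢s = ≤-from-+-≡ (cost-agree₂ (x≢s ∘ sym) s∈D x∈D (λ _ → r₁-other)) lengths
      where
      lengths : len (r₁ s) + len (r₁ x) ≤ len (r s) + len (r x)
      lengths = begin
        len (r₁ s) + len (r₁ x)      ≡⟨ cong₂ _+_ (cong len (r₁-s x≢s)) (cong len r₁-x) ⟩
        i + len (r x) + suc j        ≡⟨ swap-last i (len (r x)) (suc j) ⟩
        i + suc j + len (r x)        ≤⟨ +-monoˡ-≤ (len (r x)) (≤-trans fits L≤len) ⟩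
        len (r s) + len (r x)        ∎
        where
        open ≤-Reasoning
        swap-last : ∀ a b c → a + b + c ≡ a + c + b
        swap-last = solve-∀

    next : Config (move D x y)
    next = relocate rerouted x∈D y∉D tail (sym (cong target r₁-x))

    cost-decreases : cost⟨ next ⟩ < cost⟨ σ ⟩
    cost-decreases = ≤-trans (≤-reflexive (sym slide)) rerouted-cost
      where
      slide : cost⟨ rerouted ⟩ ≡ suc cost⟨ next ⟩
      slide = ≡-from-+-suc (sym (trans (cong (λ ρ → cost⟨ next ⟩ + len ρ) (sym r₁-x))
                                       (cost-move tail x∈D y∉D)))

    ts-step : TSStep G D (move D x y)
    ts-step = x , y , x∈D , y∉D , edge , refl

  module Descent (Inv : ∀ {D} → Config D → Set) (dominates : ∀ {D} {σ : Config D} → Inv σ → IsD2DS G D)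
                 (slack : ℕ) where

    record Progress {D} (σ : Config D) : Set where
      constructor progress
      field
        {D′}    : Subset (n G)
        σ′      : Config D′
        inv′    : Inv σ′
        ts-step : TSStep G D D′
        cheaper : cost⟨ σ′ ⟩ < cost⟨ σ ⟩

    Finish : ∀ {D} → Config D → Set
    Finish {D} σ = ∃[ q ] (q ≤ cost⟨ σ ⟩ + slack × TSSeq G D E q)

    descend : (∀ {D} (σ : Config D) → Inv σ → Finish σ ⊎ Progress σ) →
              ∀ c {D} (σ : Config D) → Inv σ → cost⟨ σ ⟩ ≤ c → ∃[ q ] (q ≤ c + slack × TSSeq G D E q)
    descend next-step c σ inv σ≤c with next-step σ inv
    ... | inj₁ (q , q≤ , seq) = q , ≤-trans q≤ (+-monoˡ-≤ slack σ≤c) , seq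
    ... | inj₂ (progress σ′ inv′ st σ′<σ) with c
    ...   | zero with () ← ≤-trans σ′<σ σ≤c
    ...   | suc c′ with descend next-step c′ σ′ inv′ (≤-pred (≤-trans σ′<σ σ≤c))
    ...     | q , q≤ , seq = suc q , s≤s q≤ , step (dominates inv) st seq

  final-move : ∀ {D x y} → IsD2DS G D → x ∈ D → y ∉ D → Adj G x y → ∣ D ∣ ≡ ∣ E ∣ →
               E ⊆ move D x y → TSSeq G D E 1
  final-move {D} {x} {y} d x∈D y∉D e ∣D∣≡∣E∣ E⊆ =
    step d (x , y , x∈D , y∉D , e , refl)
      (subst (λ F → TSSeq G F E 0) (sym (⊆-∣∣-≡ E⊆ (trans (∣move∣ D x∈D y∉D) ∣D∣≡∣E∣))) (done E-d2ds))

  covered-except : ∀ {D : Subset (n G)} {τ} → ¬ ∃ (λ t → t ∈ E × t ∉ D × t ≢ τ) →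
                 ∀ {t} → t ∈ E → t ≢ τ → t ∈ D
  covered-except {D} none {t} t∈E t≢τ with t ∈? D
  ... | yes t∈D = t∈D
  ... | no  t∉D = ⊥-elim (none (t , t∈E , t∉D , t≢τ))

  -- No route passes through k₂, so k₂ stays in D and every set dominates; the token on k₂ is
  -- delivered last, by at most two moves through k.
  module Parked (k k₂ : V) (k∈K : k ∈ K) (k₂∈K : k₂ ∈ K) (k≢k₂ : k ≢ k₂) where

    K₂Route : Route k₂ → Set
    K₂Route ρ = (target ρ ≡ k × 1 ≤ len ρ) ⊎ (Adj G k (target ρ) × target ρ ∉ K × 2 ≤ len ρ)

    record Inv {D} (σ : Config D) : Set where
      field
        k₂∈D     : k₂ ∈ D
        avoids   : ∀ {v} → v ∈ D → v ≢ k₂ → Along (_≢ k₂) (walk (routes σ v))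
        k₂-route : K₂Route (routes σ k₂)
    open Inv

    k₂∉E : ∀ {D} {σ : Config D} → Inv σ → k₂ ∉ E
    k₂∉E {σ = σ} inv k₂∈E with covers σ k₂∈E
    ... | v , v∈D , target≡k₂ with v ≟ᶠ k₂ | k₂-route inv
    ...   | yes refl | inj₁ (target≡k , _)      = k≢k₂ (trans (sym target≡k) target≡k₂)
    ...   | yes refl | inj₂ (_ , target∉K , _)  = target∉K (subst (_∈ K) (sym target≡k₂) k₂∈K)
    ...   | no  v≢k₂ | _ = Along-last (walk (routes σ v)) (avoids inv v∈D v≢k₂) target≡k₂

    open Descent Inv (λ inv → clique-vertex-dominates connected k₂∈K (k₂∈D inv)) 0

    advance : ∀ {D s} (σ : Config D) → Inv σ → s ∈ D → s ≢ k₂ → target (routes σ s) ∉ D → Progress σ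
    advance {D} {s} σ inv s∈D s≢k₂ t∉D =
      progress next inv′ ts-step cost-decreases
      where
      open Advance σ s∈D (exit (walk (routes σ s)) (avoids inv s∈D s≢k₂) s∈D t∉D) ≤-refl
      x≢k₂ : x ≢ k₂
      x≢k₂ = Along-last prefix prefix-along
      y≢k₂ : y ≢ k₂
      y≢k₂ y≡k₂ = y∉D (subst (_∈ D) (sym y≡k₂) (k₂∈D inv))
      rerouted-avoids : ∀ {v} → v ∈ D → v ≢ k₂ → v ≢ x → Along (_≢ k₂) (walk (r₁ v))
      rerouted-avoids {v} v∈D v≢k₂ v≢x with v ≟ᶠ s
      ... | yes refl = subst (Along (_≢ k₂) ∘ walk) (sym (r₁-s (v≢x ∘ sym)))
                         (Along-++ prefix (walk (r x)) prefix-along (avoids inv x∈D x≢k₂))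
      ... | no  v≢s  = subst (Along (_≢ k₂) ∘ walk) (sym (r₁-other v≢s v≢x)) (avoids inv v∈D v≢k₂)
      inv′ : Inv next
      inv′ .k₂∈D = ∈-move⁺ (x≢k₂ ∘ sym) (k₂∈D inv)
      inv′ .avoids {v} v∈ v≢k₂ with v ≟ᶠ y
      ... | yes refl = subst (Along (_≢ k₂) ∘ walk) (sym (setRoute-here r₁ y tail)) suffix-along
      ... | no  v≢y  = subst (Along (_≢ k₂) ∘ walk) (sym (setRoute-elsewhere r₁ y tail v≢y))
                         (rerouted-avoids (∈-move⁻ v≢y v∈) v≢k₂ v≢x)
        where
        v≢x : v ≢ x
        v≢x refl = ∉-move-source v≢y v∈
      inv′ .k₂-route = subst K₂Route (sym (begin
        setRoute r₁ y tail k₂   ≡⟨ setRoute-elsewhere r₁ y tail (y≢k₂ ∘ sym) ⟩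
        r₁ k₂                   ≡⟨ r₁-other (s≢k₂ ∘ sym) (x≢k₂ ∘ sym) ⟩
        r k₂                    ∎)) (k₂-route inv)
        where open ≡-Reasoning

    module Endgame {D} (σ : Config D) (inv : Inv σ) (τ∉D : target (routes σ k₂) ∉ D)
                   (others : ∀ {t} → t ∈ E → t ≢ target (routes σ k₂) → t ∈ D) where

      τ : V
      τ = target (routes σ k₂)

      t≢k₂ : ∀ {t} → t ∈ E → t ≢ k₂
      t≢k₂ t∈E refl = k₂∉E inv t∈E

      k₂k : Adj G k₂ k
      k₂k = clique k₂ k k₂∈K k∈K (k≢k₂ ∘ sym)

      dominating : IsD2DS G D
      dominating = clique-vertex-dominates connected k₂∈K (k₂∈D inv)

      one-move : τ ≡ k → TSSeq G D E 1
      one-move τ≡k = final-move dominating (k₂∈D inv) τ∉D (subst (Adj G k₂) (sym τ≡k) k₂k) (size σ) E⊆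
        where
        E⊆ : E ⊆ move D k₂ τ
        E⊆ {t} t∈E with t ≟ᶠ τ
        ... | yes refl = ∈-move-target
        ... | no  t≢τ  = ∈-move⁺ (t≢k₂ t∈E) (others t∈E t≢τ)

      two-moves : Adj G k τ → τ ∉ K → TSSeq G D E 2
      two-moves kτ τ∉K with k ∈? D
      ... | no k∉D = step dominating (k₂ , k , k₂∈D inv , k∉D , k₂k , refl)
                       (final-move (clique-vertex-dominates connected k∈K ∈-move-target) ∈-move-target
                                   τ∉D₁ kτ (trans (∣move∣ D (k₂∈D inv) k∉D) (size σ)) E⊆)
        where
        τ≢k : τ ≢ k
        τ≢k τ≡k = τ∉K (subst (_∈ K) (sym τ≡k) k∈K)
        τ∉D₁ : τ ∉ move D k₂ k
        τ∉D₁ = τ∉D ∘ ∈-move⁻ τ≢k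
        E⊆ : E ⊆ move (move D k₂ k) k τ
        E⊆ {t} t∈E with t ≟ᶠ τ
        ... | yes refl = ∈-move-target
        ... | no  t≢τ  = ∈-move⁺ (λ { refl → k∉D t∈D }) (∈-move⁺ (t≢k₂ t∈E) t∈D)
          where
          t∈D = others t∈E t≢τ
      ... | yes k∈D = step dominating (k , τ , k∈D , τ∉D , kτ , refl)
                        (final-move (clique-vertex-dominates connected k₂∈K k₂∈D₁) k₂∈D₁ (∉-move-source k≢τ) k₂k
                                    (trans (∣move∣ D k∈D τ∉D) (size σ)) E⊆)
        where
        k≢τ : k ≢ τ
        k≢τ k≡τ = τ∉K (subst (_∈ K) k≡τ k∈K)
        k₂∈D₁ : k₂ ∈ move D k τ
        k₂∈D₁ = ∈-move⁺ (k≢k₂ ∘ sym) (k₂∈D inv)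
        E⊆ : E ⊆ move (move D k τ) k₂ k
        E⊆ {t} t∈E with t ≟ᶠ k | t ≟ᶠ τ
        ... | yes refl | _        = ∈-move-target
        ... | no  t≢k  | yes refl = ∈-move⁺ (t≢k₂ t∈E) ∈-move-target
        ... | no  t≢k  | no  t≢τ  = ∈-move⁺ (t≢k₂ t∈E) (∈-move⁺ t≢k (others t∈E t≢τ))

      within-cost : ∀ {q} → q ≤ len (routes σ k₂) → q ≤ cost⟨ σ ⟩ + 0
      within-cost q≤ = ≤-trans q≤ (≤-trans (len≤cost (k₂∈D inv)) (m≤m+n _ 0))

      endgame : Finish σ
      endgame with k₂-route inv
      ... | inj₁ (τ≡k , 1≤len)      = 1 , within-cost 1≤len , one-move τ≡k
      ... | inj₂ (kτ , τ∉K , 2≤len) = 2 , within-cost 2≤len , two-moves kτ τ∉K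

    next-step : ∀ {D} (σ : Config D) → Inv σ → Finish σ ⊎ Progress σ
    next-step {D} σ inv with any? (λ t → t ∈? E ×-dec (¬? (t ∈? D) ×-dec ¬? (t ≟ᶠ τ)))
      where τ = target (routes σ k₂)
    ... | yes (t , t∈E , t∉D , t≢τ) with covers σ t∈E
    ...   | s , s∈D , refl = inj₂ (advance σ inv s∈D (λ { refl → t≢τ refl }) t∉D)
    next-step {D} σ inv | no none with target (routes σ k₂) ∈? D
    ... | yes τ∈D = inj₁ (0 , z≤n , arrived (clique-vertex-dominates connected k₂∈K (k₂∈D inv)) σ E⊆D)
      where
      E⊆D : E ⊆ D
      E⊆D {t} t∈E with t ≟ᶠ target (routes σ k₂)
      ... | yes refl = τ∈D
      ... | no  t≢τ  = covered-except none t∈E t≢τ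
    ... | no  τ∉D = inj₁ (Endgame.endgame σ inv τ∉D (covered-except none))

    parked-reconfiguration : ∀ {D} (σ : Config D) → Inv σ → ∃[ q ] (q ≤ cost⟨ σ ⟩ × TSSeq G D E q)
    parked-reconfiguration σ inv with descend next-step cost⟨ σ ⟩ σ inv ≤-refl
    ... | q , q≤ , seq = q , ≤-trans q≤ (≤-reflexive (+-identityʳ _)) , seq

  module Free where

    open Descent (λ {D} _ → IsD2DS G D) (λ d → d) 2 public

    advance-to : ∀ {D P s} (σ : Config D) (s∈D : s ∈ D) (ex : Exit D P s (target (routes σ s)) (len (routes σ s))) →
                 IsD2DS G (move D (Exit.x ex) (Exit.y ex)) → Progress σ
    advance-to σ s∈D ex d = progress next d ts-step cost-decreases
      where open Advance σ s∈D ex ≤-refl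

    module Rescue {D k k₂} (σ : Config D) (d : IsD2DS G D) (k∈K : k ∈ K) (k∈D : k ∈ D)
                  (only-k : ∀ {a} → a ∈ K → a ∈ D → a ≡ k) (k₂∈K : k₂ ∈ K) (k≢k₂ : k ≢ k₂) where

      r : Routes
      r = routes σ

      k₂∉D : k₂ ∉ D
      k₂∉D k₂∈D = k≢k₂ (sym (only-k k₂∈K k₂∈D))

      ∈D⇒≢k₂ : ∀ {v} → v ∈ D → v ≢ k₂
      ∈D⇒≢k₂ v∈D refl = k₂∉D v∈D

      ∉K⇒≢k₂ : ∀ {v} → v ∉ K → v ≢ k₂
      ∉K⇒≢k₂ v∉K refl = v∉K k₂∈K

      -- What k's route must look like for the route k₂k ◂ (route of k) to be a K₂Route.
      Home : V → ℕ → Set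
      Home u ℓ = u ≡ k ⊎ (Adj G k u × u ∉ K × 1 ≤ ℓ)

      Escape : V → V → ℕ → Set
      Escape v u L = Σ (Exit D (λ _ → ⊤) v u L) (λ ex → Exit.y ex ∈ K)

      Parkable : V → V → ℕ → Set
      Parkable v u L = ∃[ ℓ ] (ℓ ≤ L × Σ (Walk G v u ℓ) λ w → Along (_≢ k₂) w × (v ≡ k → Home u ℓ))

      home-hop : ∀ {v u} → u ∈ D → Adj G v u → v ≡ k → Home u 1
      home-hop {u = u} u∈D e refl with u ∈? K
      ... | yes u∈K = inj₁ (only-k u∈K u∈D)
      ... | no  u∉K = inj₂ (e , u∉K , s≤s z≤n)

      classify-shortcut : ∀ {v u ℓ} → v ∈ D → Shortcut v u ℓ → Escape v u ℓ ⊎ Parkable v u ℓ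
      classify-shortcut v∈D stay = inj₂ (0 , ≤-refl , nil , ∈D⇒≢k₂ v∈D , inj₁)
      classify-shortcut {v} {u} v∈D (hop e) with u ∈? D | u ∈? K
      ... | yes u∈D | _        = inj₂ (1 , ≤-refl , cons e nil , (∈D⇒≢k₂ v∈D , ∈D⇒≢k₂ u∈D) , home-hop u∈D e)
      ... | no  u∉D | yes u∈K  = inj₁ (exitVia v∈D u∉D nil e nil ≤-refl tt tt , u∈K)
      ... | no  u∉D | no  u∉K  = inj₂ (1 , ≤-refl , cons e nil , (∈D⇒≢k₂ v∈D , ∉K⇒≢k₂ u∉K) ,
                                        λ { refl → inj₂ (e , u∉K , s≤s z≤n) })
      classify-shortcut {v} {u} v∈D (via a a∈K e₁ e₂) with a ∈? D
      ... | no  a∉D = inj₁ (exitVia v∈D a∉D nil e₁ (cons e₂ nil) ≤-refl tt (tt , tt) , a∈K)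
      ... | yes a∈D with only-k a∈K a∈D | u ∈? K
      ...   | refl | no  u∉K = inj₂ (2 , ≤-refl , cons e₁ (cons e₂ nil) ,
                                      (∈D⇒≢k₂ v∈D , k≢k₂ , ∉K⇒≢k₂ u∉K) , λ { refl → ⊥-elim (irrefl G k e₁) })
      ...   | refl | yes u∈K with u ∈? D
      ...     | yes u∈D = ⊥-elim (irrefl G k (subst (Adj G k) (only-k u∈K u∈D) e₂))
      ...     | no  u∉D = inj₁ (exitVia a∈D u∉D (cons e₁ nil) e₂ nil ≤-refl (tt , tt) tt , u∈K)
      classify-shortcut v∈D (via₂ a b a∈K b∈K e₁ e₂ e₃) with a ∈? D | b ∈? D
      ... | no  a∉D | _       = inj₁ (exitVia v∈D a∉D nil e₁ (cons e₂ (cons e₃ nil)) ≤-refl tt (tt , tt , tt) , a∈K)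
      ... | yes a∈D | no  b∉D = inj₁ (exitVia a∈D b∉D (cons e₁ nil) e₂ (cons e₃ nil) ≤-refl (tt , tt) (tt , tt) , b∈K)
      ... | yes a∈D | yes b∈D =
            ⊥-elim (irrefl G a (subst (Adj G a) (trans (only-k b∈K b∈D) (sym (only-k a∈K a∈D))) e₂))

      classify : ∀ v → (∃[ v∈D ] Escape v (target (r v)) (len (r v)))
                       ⊎ (v ∈ D → Parkable v (target (r v)) (len (r v)))
      classify v with v ∈? D
      ... | no  v∉D = inj₂ (λ v∈D → ⊥-elim (v∉D v∈D))
      ... | yes v∈D with shortcut (walk (r v))
      ...   | ℓ , ℓ≤len , sc with classify-shortcut v∈D sc
      ...     | inj₁ (ex , y∈K)                = inj₁ (v∈D , Exit-weaken ℓ≤len ex , y∈K)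
      ...     | inj₂ (ℓ′ , ℓ′≤ℓ , w , Pw , home) = inj₂ (λ _ → ℓ′ , ≤-trans ℓ′≤ℓ ℓ≤len , w , Pw , home)

      module Park (stuck : ∀ v → v ∈ D → Parkable v (target (r v)) (len (r v))) where

        record Shortened (v : V) : Set where
          field
            shortened   : Route v
            same-target : target shortened ≡ target (r v)
            shorter     : len shortened ≤ len (r v)
            avoiding    : v ∈ D → Along (_≢ k₂) (walk shortened)
            homing      : v ∈ D → v ≡ k → Home (target shortened) (len shortened)
        open Shortened

        shorten : ∀ v → Shortened v
        shorten v with v ∈? D
        ... | yes v∈D with stuck v v∈D
        ...   | ℓ , ℓ≤ , w , Pw , home = record
                  { shortened = route _ ℓ w ; same-target = refl ; shorter = ℓ≤
                  ; avoiding = λ _ → Pw ; homing = λ _ → home }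
        shorten v | no v∉D = record
                  { shortened = r v ; same-target = refl ; shorter = ≤-refl
                  ; avoiding = λ v∈D → ⊥-elim (v∉D v∈D) ; homing = λ v∈D → ⊥-elim (v∉D v∈D) }

        r₁ : Routes
        r₁ v = shortened (shorten v)

        σ₁ : Config D
        σ₁ = record { routes = r₁ ; covers = covers₁ ; size = size σ }
          where
          covers₁ : ∀ {t} → t ∈ E → ∃[ v ] (v ∈ D × target (r₁ v) ≡ t)
          covers₁ t∈E with covers σ t∈E
          ... | v , v∈D , refl = v , v∈D , same-target (shorten v)

        σ₁-cost : cost⟨ σ₁ ⟩ ≤ cost⟨ σ ⟩
        σ₁-cost = cost-mono (λ v _ → shorter (shorten v))

        k₂k : Adj G k₂ k
        k₂k = clique k₂ k k₂∈K k∈K (k≢k₂ ∘ sym)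

        σ₂ : Config (move D k k₂)
        σ₂ = relocate σ₁ k∈D k₂∉D (k₂k ◂ r₁ k) refl

        σ₂-cost : cost⟨ σ₂ ⟩ ≡ suc cost⟨ σ₁ ⟩
        σ₂-cost = ≡-from-+-suc (cost-move (k₂k ◂ r₁ k) k∈D k₂∉D)

        open Parked k k₂ k∈K k₂∈K k≢k₂ using (Inv; K₂Route; parked-reconfiguration)

        parked : Inv σ₂
        parked = record
          { k₂∈D     = ∈-move-target
          ; avoids   = λ {v} v∈ v≢k₂ → subst (Along (_≢ k₂) ∘ walk) (sym (setRoute-elsewhere r₁ k₂ _ v≢k₂))
                                         (avoiding (shorten v) (∈-move⁻ v≢k₂ v∈))
          ; k₂-route = subst K₂Route (sym (setRoute-here r₁ k₂ _))
                         (lift (homing (shorten k) k∈D refl))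
          }
          where
          lift : Home (target (r₁ k)) (len (r₁ k)) → K₂Route (k₂k ◂ r₁ k)
          lift (inj₁ τ≡k)            = inj₁ (τ≡k , s≤s z≤n)
          lift (inj₂ (kτ , τ∉K , 1≤ℓ)) = inj₂ (kτ , τ∉K , s≤s 1≤ℓ)

        park : Finish σ
        park with parked-reconfiguration σ₂ parked
        ... | q , q≤ , seq = suc q , bound , step d (k , k₂ , k∈D , k₂∉D , adj-sym G k₂k , refl) seq
          where
          bound : suc q ≤ cost⟨ σ ⟩ + 2
          bound = begin
            suc q                    ≤⟨ s≤s (≤-trans q≤ (≤-reflexive σ₂-cost)) ⟩
            suc (suc cost⟨ σ₁ ⟩)     ≤⟨ s≤s (s≤s σ₁-cost) ⟩
            suc (suc cost⟨ σ ⟩)      ≡⟨ +-comm 2 cost⟨ σ ⟩ ⟩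
            cost⟨ σ ⟩ + 2            ∎
            where open ≤-Reasoning

      rescue : Finish σ ⊎ Progress σ
      rescue with some-or-all classify
      ... | inj₁ (v , v∈D , ex , y∈K) =
            inj₂ (advance-to σ v∈D ex (clique-vertex-dominates connected y∈K ∈-move-target))
      ... | inj₂ stuck                = inj₁ (Park.park stuck)

    module Leave {D s} (σ : Config D) (d : IsD2DS G D) (s∈D : s ∈ D)
                 (ex : Exit D (λ _ → ⊤) s (target (routes σ s)) (len (routes σ s))) where

      open Exit ex

      advance-dominated : IsD2DS G (move D x y) → Progress σ
      advance-dominated = advance-to σ s∈D ex

      leave : Finish σ ⊎ Progress σ
      leave with y ∈? K
      ... | yes y∈K = inj₂ (advance-dominated (clique-vertex-dominates connected y∈K ∈-move-target))
      ... | no  y∉K with any? (λ a → (a ∈? K ×-dec a ∈? D) ×-dec ¬? (a ≟ᶠ x))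
      ...   | yes (a , (a∈K , a∈D) , a≢x) =
              inj₂ (advance-dominated (clique-vertex-dominates connected a∈K (∈-move⁺ a≢x a∈D)))
      ...   | no  x-only with any? (λ a → a ∈? K ×-dec ¬? (a ≟ᶠ x))
      ...     | yes (k₂ , k₂∈K , k₂≢x) =
                Rescue.rescue σ d (adj-to-clique (adj-sym G edge) y∉K) x∈D
                              (λ a∈K a∈D → ¬∃≢⇒≡ x-only (a∈K , a∈D)) k₂∈K (k₂≢x ∘ sym)
      ...     | no  K-is-x =
                inj₂ (advance-dominated (leaf-of-star-dominates connected (λ a a∈K → ¬∃≢⇒≡ K-is-x a∈K)
                                                                 edge ∈-move-target))

    next-step : ∀ {D} (σ : Config D) → IsD2DS G D → Finish σ ⊎ Progress σ
    next-step {D} σ d with any? (λ t → t ∈? E ×-dec ¬? (t ∈? D))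
    ... | yes (t , t∈E , t∉D) with covers σ t∈E
    ...   | s , s∈D , refl = Leave.leave σ d s∈D (exit (walk (routes σ s)) (Along-⊤ (walk (routes σ s))) s∈D t∉D)
    next-step {D} σ d | no none = inj₁ (0 , z≤n , arrived d σ E⊆D)
      where
      E⊆D : E ⊆ D
      E⊆D {t} t∈E with t ∈? D
      ... | yes t∈D = t∈D
      ... | no  t∉D = ⊥-elim (none (t , t∈E , t∉D))

    free-reconfiguration : ∀ {D} (σ : Config D) → IsD2DS G D → ∃[ q ] (q ≤ cost⟨ σ ⟩ + 2 × TSSeq G D E q)
    free-reconfiguration σ d = descend next-step cost⟨ σ ⟩ σ d ≤-refl

  module Matching {Ds : Subset (n G)} (f : Elem G Ds ⤖ Elem G E) (d : (v : V) → v ∈ Ds → ℕ)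
                  (walks : ∀ v (p : v ∈ Ds) → Walk G v (proj₁ (Bijection.to f (v , p))) (d v p)) where

    matched : Routes
    matched v with v ∈? Ds
    ... | yes p = route (proj₁ (Bijection.to f (v , p))) (d v p) (walks v p)
    ... | no  _ = route v 0 nil

    matched-target : ∀ {v} (p : v ∈ Ds) → target (matched v) ≡ proj₁ (Bijection.to f (v , p))
    matched-target {v} p with v ∈? Ds
    ... | yes p′  = cong (λ q → proj₁ (Bijection.to f (v , q))) ([]=-irrelevant p′ p)
    ... | no  v∉D = ⊥-elim (v∉D p)

    matched-len : ∀ {v} (p : v ∈ Ds) → len (matched v) ≡ d v p
    matched-len {v} p with v ∈? Ds
    ... | yes p′  = cong (d v) ([]=-irrelevant p′ p)
    ... | no  v∉D = ⊥-elim (v∉D p)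

    matching-config : ∣ Ds ∣ ≡ ∣ E ∣ → Config Ds
    matching-config ∣Ds∣≡∣E∣ = record { routes = matched ; covers = covers₀ ; size = ∣Ds∣≡∣E∣ }
      where
      covers₀ : ∀ {t} → t ∈ E → ∃[ v ] (v ∈ Ds × target (matched v) ≡ t)
      covers₀ t∈E with Bijection.strictlySurjective f (_ , t∈E)
      ... | (v , p) , to≡t = v , p , trans (matched-target p) (cong proj₁ to≡t)

    matching-cost : sumOver G Ds d ≡ cost Ds matched
    matching-cost = trans (sum-map-tabulate summand id) (sum-cong-≗ summand≗weight)
      where
      summand : V → ℕ
      summand = summandOf {x = sumOver G Ds d} refl
      summand≗weight : ∀ v → summand v ≡ weight Ds matched v
      summand≗weight v with v ∈? Ds
      ... | yes p = sym (matched-len p)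
      ... | no  _ = refl

    reconfigure : IsD2DS G Ds → ∣ Ds ∣ ≡ ∣ E ∣ → ∃[ q ] (q ≤ sumOver G Ds d + 2 × TSSeq G Ds E q)
    reconfigure Ds-d2ds ∣Ds∣≡∣E∣ = subst (λ c → ∃[ q ] (q ≤ c + 2 × TSSeq G Ds E q)) (sym matching-cost)
                                     (Free.free-reconfiguration (matching-config ∣Ds∣≡∣E∣) Ds-d2ds)

lemma14 : (G : Graph) → Connected G → IsSplit G
    → (Ds Dt : Subset (n G)) → IsD2DS G Ds → IsD2DS G Dt → ∣ Ds ∣ ≡ ∣ Dt ∣
    → (m : ℕ) → IsMStar G Ds Dt m
    → ∃[ q ] (q ≤ m + 2 × TSSeq G Ds Dt q)
lemma14 G connected (K , clique , independent) Ds Dt Ds-d2ds Dt-d2ds ∣Ds∣≡∣Dt∣ _ ((f , d , dist , refl) , _) =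
  Matching.reconfigure f d (λ v p → proj₁ (dist v p)) Ds-d2ds ∣Ds∣≡∣Dt∣
  where open Reconfiguration G K clique independent connected Dt Dt-d2ds
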